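{- Let $\epsilon$ be a positive integer. Let $G=\langle\alpha,\beta\rangle$ be the group of bijections of $\mathbb{Q}_+^5$ generated by $$\alpha(a,b,c,d,e)=\Big(b,\tfrac{b^2+cd}{a},c,d,e\Big),\qquad \beta(a,b,c,d,e)=\Big(b,c,\tfrac{ac+be}{d},a,e\Big).$$ Let $$T(a,b,c,d,e)=\frac{ab(c^2+d^2+e^2)+(a^2+b^2+cd)(c+d)e}{abcd}-9,$$ and let $\varphi:\mathbb{Q}_+^5\to\mathbb{Q}_+^3$ be $$\varphi(a,b,c,d,e)=\Big(\frac{a^2+b^2+cd}{ab},\ \frac{c^2d+a^2c+b^2d+abe}{bcd},\ \frac{cd^2+a^2c+b^2d+abe}{acd}\Big).$$ Then a positive integer solution $P=(a,b,c,d,\epsilon)\in\mathbb{N}^5$ of $T(a,b,c,d,\epsilon)=0$ lies in the orbit $G(\epsilon,\epsilon,\epsilon,\epsilon,\epsilon)$ if and only if $\varphi(P)\in\mathbb{N}^3$ and $P\equiv 0\pmod{\epsilon}$. That is, $$G(\epsilon,\epsilon,\epsilon,\epsilon,\epsilon)=\{P=(a,b,c,d,\epsilon)\in\mathbb{N}^5\mid T(P)=0,\ \varphi(P)\in\mathbb{N}^3,\ P\equiv 0\pmod{\epsilon}\}.$$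
   Context: $\mathbb{N}$ denotes the positive integers and $\mathbb{Q}_+$ the positive rationals. $G(x)=\{g(x)\mid g\in G\}$ denotes the orbit. For a vector $P$, $P\equiv 0\pmod{\epsilon}$ means every component of $P$ is divisible by $\epsilon$. -}

module Defs where

open import Data.Nat using (ℕ; NonZero; suc)
open import Data.Integer using (+_)
open import Data.Rational using (ℚ; _+_; _*_; _÷_; 1/_; _-_; _/_; Positive; 0ℚ)
open import Data.Rational.Properties using (pos+pos⇒pos; pos*pos⇒pos; pos⇒nonZero; 1/pos⇒pos; normalize-pos)
open import Data.Product using (∃)
open import Relation.Binary.PropositionalEquality using (_≡_)

record ℚ⁺ : Set where
  constructor mk⁺
  field
    val : ℚ
    .pos : Positive val
open ℚ⁺ public

_+⁺_ : ℚ⁺ → ℚ⁺ → ℚ⁺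
mk⁺ p hp +⁺ mk⁺ q hq = mk⁺ (p + q) (pos+pos⇒pos p {{hp}} q {{hq}})

_*⁺_ : ℚ⁺ → ℚ⁺ → ℚ⁺
mk⁺ p hp *⁺ mk⁺ q hq = mk⁺ (p * q) (pos*pos⇒pos p {{hp}} q {{hq}})

1/⁺_ : ℚ⁺ → ℚ⁺
1/⁺ mk⁺ q hq = mk⁺ ((1/ q) {{pos⇒nonZero q {{hq}}}}) (1/pos⇒pos q {{hq}})

_/⁺_ : ℚ⁺ → ℚ⁺ → ℚ⁺
p /⁺ q = p *⁺ (1/⁺ q)

infixl 6 _+⁺_
infixl 7 _*⁺_ _/⁺_

ℕ⁺ : (n : ℕ) → .{{NonZero n}} → ℚ⁺
ℕ⁺ n = mk⁺ (+ n / 1) (normalize-pos n 1)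

record Pt : Set where
  constructor ⟨_,_,_,_,_⟩
  field
    a b c d e : ℚ⁺
open Pt public

α : Pt → Pt
α ⟨ a , b , c , d , e ⟩ = ⟨ b , (b *⁺ b +⁺ c *⁺ d) /⁺ a , c , d , e ⟩

β : Pt → Pt
β ⟨ a , b , c , d , e ⟩ = ⟨ b , c , (a *⁺ c +⁺ b *⁺ e) /⁺ d , a , e ⟩

-- Orbit x y : y ∈ G(x), G = ⟨α, β⟩ the group generated by the bijections α, β.
-- y is obtained from x by a finite word in α, β, α⁻¹, β⁻¹
-- (applying α⁻¹ to y = going from α z back to z).
data Orbit (x : Pt) : Pt → Set where
  here  : Orbit x x
  by-α  : ∀ {y} → Orbit x y → Orbit x (α y)
  by-β  : ∀ {y} → Orbit x y → Orbit x (β y)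
  by-α⁻ : ∀ {y} → Orbit x (α y) → Orbit x y
  by-β⁻ : ∀ {y} → Orbit x (β y) → Orbit x y

diag : (ε : ℕ) → .{{NonZero ε}} → Pt
diag ε = ⟨ ℕ⁺ ε , ℕ⁺ ε , ℕ⁺ ε , ℕ⁺ ε , ℕ⁺ ε ⟩

IsNat : ℚ → Set
IsNat q = ∃ λ (n : ℕ) → q ≡ + n / 1

_≡ℕ_ : ℚ → ℕ → Set
q ≡ℕ n = q ≡ + n / 1

T : Pt → ℚ
T ⟨ a , b , c , d , e ⟩ =
  val ((a *⁺ b *⁺ (c *⁺ c +⁺ d *⁺ d +⁺ e *⁺ e)
        +⁺ (a *⁺ a +⁺ b *⁺ b +⁺ c *⁺ d) *⁺ (c +⁺ d) *⁺ e)
       /⁺ (a *⁺ b *⁺ c *⁺ d))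
  - (+ 9 / 1)

φ₁ φ₂ φ₃ : Pt → ℚ
φ₁ ⟨ a , b , c , d , e ⟩ = val ((a *⁺ a +⁺ b *⁺ b +⁺ c *⁺ d) /⁺ (a *⁺ b))
φ₂ ⟨ a , b , c , d , e ⟩ =
  val ((c *⁺ c *⁺ d +⁺ a *⁺ a *⁺ c +⁺ b *⁺ b *⁺ d +⁺ a *⁺ b *⁺ e) /⁺ (b *⁺ c *⁺ d))
φ₃ ⟨ a , b , c , d , e ⟩ =
  val ((c *⁺ d *⁺ d +⁺ a *⁺ a *⁺ c +⁺ b *⁺ b *⁺ d +⁺ a *⁺ b *⁺ e) /⁺ (a *⁺ c *⁺ d))

{-# OPTIONS --safe #-}
-- Write P = ε · (a, b, c, d, 1).  P satisfies the conditions exactly when (a, b, c, d) is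
-- admissible: φ takes integer values k₁, k₂, k₃ and T = 0, which after substituting φ₁ = k₁
-- reads c² + d² + 1 + k₁ (c + d) = 9 c d.  The generators act on such quadruples as Vieta
-- moves that preserve admissibility; for β this uses that (a c + b) / d is a rational root
-- of a monic integer quadratic, hence an integer.  So the orbit of ε · (1, 1, 1, 1) consists
-- of such points.  Conversely, descend along α, β, α⁻¹, β⁻¹ as long as one of them lowers
-- a + b + c + d.  At a quadruple where none does, elementary inequalities bound a, b, c, d
-- and k₁, and a finite search leaves only (1, 1, 1, 1).
module Submission where

open import Defs
open import Data.Nat using (ℕ; NonZero)
open import Data.Nat.Divisibility using (_∣_)
open import Data.Rational using (0ℚ)
open import Data.Product using (_×_; ∃)
open import Function.Bundles using (_⇔_)
open import Relation.Binary.PropositionalEquality using (_≡_)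

open import Data.Nat
open import Data.Nat.Properties
open import Data.Nat.Tactic.RingSolver using (solve)
open import Data.Nat.Divisibility using (divides; ∣m+n∣m⇒∣n; m∣m*n; ∣-refl)
open import Data.Nat.GCD using (gcd; gcd[m,n]∣m; gcd[m,n]∣n; gcd[m,n]≢0)
open import Data.Nat.DivMod using (m/n*n≡m)
open import Data.Nat.Coprimality using (Coprime; coprime-/gcd; coprime-divisor)
import Data.Nat.Coprimality as Coprime
import Data.Integer as ℤ
import Data.Integer.Properties as ℤ
open import Data.Rational as ℚ using (ℚ; mkℚ; 1/_)
import Data.Rational.Properties as ℚ
open import Algebra.Properties.Group ℚ.+-0-group using (x∙y⁻¹≈ε⇒x≈y; x≈y⇒x∙y⁻¹≈ε)
open import Data.List using (_∷_; [])
open import Data.Product using (_,_; proj₁; proj₂; ∃-syntax)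
open import Data.Sum using (inj₁; inj₂)
open import Data.Empty using (⊥-elim)
open import Function.Bundles using (Equivalence; mk⇔)
open import Function.Properties.Equivalence using () renaming (trans to ⇔-trans)
open import Relation.Nullary using (Dec; yes; no)
open import Relation.Nullary.Decidable using (_→-dec_; _×-dec_; from-yes)
open import Relation.Binary.PropositionalEquality

-- Linear-combination certificate for L ≡ R: h : l ≡ r collects the hypotheses with their
-- multipliers, and the semiring identity states X * (L - R) = l - r without subtraction.
combine : ∀ X {L R l r} .{{_ : NonZero X}} → l ≡ r → X * L + r ≡ X * R + l → L ≡ R
combine X {L} {R} {l} refl eq = *-cancelˡ-≡ L R X (+-cancelʳ-≡ l (X * L) (X * R) eq)

infixl 7 _·_
infixl 6 _⊕_

_·_ : ∀ c {l r} → l ≡ r → c * l ≡ c * r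
c · h = cong (c *_) h

_⊕_ : ∀ {l₁ r₁ l₂ r₂} → l₁ ≡ r₁ → l₂ ≡ r₂ → l₁ + l₂ ≡ r₁ + r₂
_⊕_ = cong₂ _+_

m*n≡o⇒n≢0 : ∀ m n {o} → m * n ≡ o → .{{NonZero o}} → NonZero n
m*n≡o⇒n≢0 m n refl = m*n≢0⇒n≢0 m

m+n≢0 : ∀ m n → .{{NonZero n}} → NonZero (m + n)
m+n≢0 m (suc n) rewrite +-suc m n = _

m*n≡o+m*p⇒m*[n∸p]≡o : ∀ m n o p → m * n ≡ o + m * p → m * (n ∸ p) ≡ o
m*n≡o+m*p⇒m*[n∸p]≡o m n o p eq = begin
  m * (n ∸ p)     ≡⟨ *-distribˡ-∸ m n p ⟩
  m * n ∸ m * p   ≡⟨ cong (_∸ m * p) eq ⟩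
  o + m * p ∸ m * p ≡⟨ m+n∸n≡m o (m * p) ⟩
  o               ∎
  where open ≡-Reasoning

-- (a, b, c, d) ∈ ℕ⁴ such that φ(a, b, c, d, 1) = (k₁, k₂, k₃) and T(a, b, c, d, 1) = 0;
-- the last condition is T = 0 with its numerator divided by a b and φ₁ = k₁ substituted.
record Admissible (a b c d : ℕ) : Set where
  constructor mkAdmissible
  field
    k₁ k₂ k₃ : ℕ
    φ₁≡k₁ : a * b * k₁ ≡ a * a + b * b + c * d
    φ₂≡k₂ : b * c * d * k₂ ≡ c * c * d + a * a * c + b * b * d + a * b
    φ₃≡k₃ : a * c * d * k₃ ≡ c * d * d + a * a * c + b * b * d + a * b
    T≡0 : c * c + d * d + 1 + k₁ * (c + d) ≡ 9 * (c * d)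
    {{a≢0}} : NonZero a
    {{b≢0}} : NonZero b
    {{c≢0}} : NonZero c
    {{d≢0}} : NonZero d

admissible-1111 : Admissible 1 1 1 1
admissible-1111 = record { k₁ = 3 ; k₂ = 4 ; k₃ = 4 ; φ₁≡k₁ = refl ; φ₂≡k₂ = refl ; φ₃≡k₃ = refl ; T≡0 = refl }

admissible-swap : ∀ {a b c d} → Admissible a b c d → Admissible b a d c
admissible-swap {a} {b} {c} {d}
  (mkAdmissible k₁ k₂ k₃ φ₁≡k₁ φ₂≡k₂ φ₃≡k₃ T≡0 {{_}} {{_}} {{_}} {{_}}) = record
  { k₁ = k₁ ; k₂ = k₃ ; k₃ = k₂
  ; φ₁≡k₁ = combine 1 φ₁≡k₁ (solve (a ∷ b ∷ c ∷ d ∷ k₁ ∷ []))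
  ; φ₂≡k₂ = combine 1 φ₃≡k₃ (solve (a ∷ b ∷ c ∷ d ∷ k₃ ∷ []))
  ; φ₃≡k₃ = combine 1 φ₂≡k₂ (solve (a ∷ b ∷ c ∷ d ∷ k₂ ∷ []))
  ; T≡0 = combine 1 T≡0 (solve (c ∷ d ∷ k₁ ∷ []))
  }

admissible-α-step : ∀ {a b c d x} {{_ : NonZero x}} → a * x ≡ b * b + c * d →
                    Admissible a b c d → Admissible b x c d
admissible-α-step {a} {b} {c} {d} {x} ax≡
  (mkAdmissible k₁ k₂ k₃ φ₁≡k₁ φ₂≡k₂ φ₃≡k₃ T≡0 {{_}} {{_}} {{_}} {{_}}) = record
  { k₁ = k₁ ; k₂ = k₃ ; k₃ = k₁ * k₃ ∸ k₂
  ; φ₁≡k₁ = combine a (x · φ₁≡k₁ ⊕ a · ax≡ ⊕ x · sym ax≡) (solve (a ∷ b ∷ c ∷ d ∷ x ∷ k₁ ∷ []))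
  ; φ₂≡k₂ = combine a (x · φ₃≡k₃ ⊕ (a * c) · ax≡ ⊕ (d * x) · sym ax≡) (solve (a ∷ b ∷ c ∷ d ∷ x ∷ k₃ ∷ []))
  ; φ₃≡k₃ = m*n≡o+m*p⇒m*[n∸p]≡o (b * c * d) (k₁ * k₃) _ k₂ (combine (a * a) {{m*n≢0 a a}}
      ((a * c * d * k₃) · φ₁≡k₁ ⊕ (a * a) · sym φ₂≡k₂ ⊕ (a * a + b * b + c * d) · φ₃≡k₃
        ⊕ (a * b + a * d * x + b * b * d + c * d * d) · sym ax≡)
      (solve (a ∷ b ∷ c ∷ d ∷ x ∷ k₁ ∷ k₂ ∷ k₃ ∷ [])))
  ; T≡0 = T≡0
  }

admissible-α : ∀ {a b c d} → Admissible a b c d → ∃[ x ] a * x ≡ b * b + c * d × Admissible b x c d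
admissible-α {a} {b} {c} {d} A@(mkAdmissible k₁ _ _ φ₁≡k₁ _ _ _ {{_}} {{_}} {{_}} {{_}}) =
  b * k₁ ∸ a , ax≡ , admissible-α-step {{x≢0}} ax≡ A
  where
  ax≡ : a * (b * k₁ ∸ a) ≡ b * b + c * d
  ax≡ = m*n≡o+m*p⇒m*[n∸p]≡o a (b * k₁) _ a (combine 1 φ₁≡k₁ (solve (a ∷ b ∷ c ∷ d ∷ k₁ ∷ [])))
  x≢0 : NonZero (b * k₁ ∸ a)
  x≢0 = m*n≡o⇒n≢0 a _ ax≡ {{m+n≢0 (b * b) (c * d) {{m*n≢0 c d}}}}

coprime-root⇒d≡1 : ∀ {m d} C K L → Coprime m d → m * m + C * (d * d) + K * (m * d) ≡ L * (m * d) → d ≡ 1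
coprime-root⇒d≡1 {m} {d} C K L coprime eq = coprime (coprime-divisor (Coprime.sym coprime) d∣m*m , ∣-refl)
  where
  d∣m*m : d ∣ m * m
  d∣m*m = ∣m+n∣m⇒∣n (subst (d ∣_) (sym shifted) (m∣m*n (L * m))) (m∣m*n (C * d + K * m))
    where
    shifted : d * (C * d + K * m) + m * m ≡ d * (L * m)
    shifted = combine 1 eq (solve (m ∷ d ∷ C ∷ K ∷ L ∷ []))

quadratic-form-cancel : ∀ g m d C K L .{{_ : NonZero g}} →
  (m * g) * (m * g) + C * ((d * g) * (d * g)) + K * ((m * g) * (d * g)) ≡ L * ((m * g) * (d * g)) →
  m * m + C * (d * d) + K * (m * d) ≡ L * (m * d)
quadratic-form-cancel g m d C K L eq = combine (g * g) {{m*n≢0 g g}} eq (solve (g ∷ m ∷ d ∷ C ∷ K ∷ L ∷ []))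

-- Rational root theorem for the monic quadratic X² - (L - K) X + C at X = m / d.
quadratic-root-∣ : ∀ m d C K L → .{{_ : NonZero d}} →
                   m * m + C * (d * d) + K * (m * d) ≡ L * (m * d) → d ∣ m
quadratic-root-∣ m d C K L eq = subst (_∣ m) (sym d≡g) (gcd[m,n]∣m m d)
  where
  g = gcd m d
  instance
    g≢0 : NonZero g
    g≢0 = ≢-nonZero (gcd[m,n]≢0 m d (inj₂ (≢-nonZero⁻¹ d)))
  m/g*g≡m : m / g * g ≡ m
  m/g*g≡m = m/n*n≡m (gcd[m,n]∣m m d)
  d/g*g≡d : d / g * g ≡ d
  d/g*g≡d = m/n*n≡m (gcd[m,n]∣n m d)
  reduced : m / g * (m / g) + C * (d / g * (d / g)) + K * (m / g * (d / g)) ≡ L * (m / g * (d / g))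
  reduced = quadratic-form-cancel g (m / g) (d / g) C K L
    (subst₂ (λ u v → u * u + C * (v * v) + K * (u * v) ≡ L * (u * v)) (sym m/g*g≡m) (sym d/g*g≡d) eq)
  d≡g : d ≡ g
  d≡g = begin
    d           ≡⟨ d/g*g≡d ⟨
    d / g * g   ≡⟨ cong (_* g) (coprime-root⇒d≡1 C K L (coprime-/gcd m d) reduced) ⟩
    1 * g       ≡⟨ *-identityˡ g ⟩
    g           ∎
    where open ≡-Reasoning

β-quadratic : ∀ a b c d k₁ k₂ .{{_ : NonZero b}} .{{_ : NonZero c}} .{{_ : NonZero d}} →
  a * b * k₁ ≡ a * a + b * b + c * d → b * c * d * k₂ ≡ c * c * d + a * a * c + b * b * d + a * b →
  c * c + d * d + 1 + k₁ * (c + d) ≡ 9 * (c * d) →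
  (a * c + b) * (a * c + b) + (a * a + 1 + k₂ * a) * (d * d) + k₂ * ((a * c + b) * d) ≡ 9 * a * ((a * c + b) * d)
β-quadratic a b c d k₁ k₂ φ₁≡k₁ φ₂≡k₂ T≡0 = combine (b * c * d) {{m*n≢0 (b * c) d {{m*n≢0 b c}}}}
  ((a * c * d + a * d * d + b * d) · φ₂≡k₂ ⊕ (a * a * b * c * d + a * b * b * d) · T≡0
    ⊕ (a * c * c * d + a * c * d * d + b * c * d + b * d * d) · sym φ₁≡k₁)
  (solve (a ∷ b ∷ c ∷ d ∷ k₁ ∷ k₂ ∷ []))

admissible-β-step : ∀ {a b c d x} {{_ : NonZero x}} → d * x ≡ a * c + b →
                    Admissible a b c d → Admissible b c x a
admissible-β-step {a} {b} {c} {d} {x} dx≡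
  (mkAdmissible k₁ k₂ k₃ φ₁≡k₁ φ₂≡k₂ φ₃≡k₃ T≡0 {{_}} {{_}} {{_}} {{_}}) = record
  { k₁ = k₂ ; k₂ = k₃ ; k₃ = k₁
  ; φ₁≡k₁ = combine d (φ₂≡k₂ ⊕ a · sym dx≡) (solve (a ∷ b ∷ c ∷ d ∷ x ∷ k₂ ∷ []))
  ; φ₂≡k₂ = combine (a * d * d) {{m*n≢0 (a * d) d {{m*n≢0 a d}}}}
      ((a * d * x) · φ₃≡k₃ ⊕ (a * c * d * d) · dx≡ ⊕ (a * a * d * x) · sym dx≡)
      (solve (a ∷ b ∷ c ∷ d ∷ x ∷ k₃ ∷ []))
  ; φ₃≡k₃ = combine d ((d * x) · φ₁≡k₁ ⊕ (c * d) · dx≡) (solve (a ∷ b ∷ c ∷ d ∷ x ∷ k₁ ∷ []))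
  ; T≡0 = combine (d * d) {{m*n≢0 d d}}
      (β-quadratic a b c d k₁ k₂ φ₁≡k₁ φ₂≡k₂ T≡0 ⊕ (a * c + b + d * k₂ + d * x) · dx≡ ⊕ (9 * a * d) · sym dx≡)
      (solve (a ∷ b ∷ c ∷ d ∷ x ∷ k₂ ∷ []))
  }

admissible-β : ∀ {a b c d} → Admissible a b c d → ∃[ x ] d * x ≡ a * c + b × Admissible b c x a
admissible-β {a} {b} {c} {d} A@(mkAdmissible k₁ k₂ _ φ₁≡k₁ φ₂≡k₂ _ T≡0 {{_}} {{_}} {{_}} {{_}}) =
  x , dx≡ , admissible-β-step {{x≢0}} dx≡ A
  where
  d∣ac+b : d ∣ a * c + b
  d∣ac+b = quadratic-root-∣ (a * c + b) d (a * a + 1 + k₂ * a) k₂ (9 * a)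
             (β-quadratic a b c d k₁ k₂ φ₁≡k₁ φ₂≡k₂ T≡0)
  x = _∣_.quotient d∣ac+b
  dx≡ : d * x ≡ a * c + b
  dx≡ = trans (*-comm d x) (sym (_∣_.equality d∣ac+b))
  x≢0 : NonZero x
  x≢0 = m*n≡o⇒n≢0 d x dx≡ {{m+n≢0 (a * c) b}}

admissible-α⁻¹ : ∀ {a b c d} → Admissible a b c d → ∃[ y ] b * y ≡ a * a + c * d × Admissible y a c d
admissible-α⁻¹ {a} {b} {c} {d} A =
  let y , by≡ , A′ = admissible-α (admissible-swap A)
  in y , trans by≡ (cong (a * a +_) (*-comm d c)) , admissible-swap A′

admissible-β⁻¹ : ∀ {a b c d} → Admissible a b c d → ∃[ y ] c * y ≡ b * d + a × Admissible d a b y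
admissible-β⁻¹ A =
  let y , cy≡ , A′ = admissible-β (admissible-swap A)
  in y , cy≡ , admissible-swap A′

-- Minimal admissible quadruples

AllOne : ℕ → ℕ → ℕ → ℕ → Set
AllOne a b c d = a ≡ 1 × b ≡ 1 × c ≡ 1 × d ≡ 1

≤-via : ∀ {m n} o → n ≡ m + o → m ≤ n
≤-via {m} o refl = m≤m+n m o

m*n*2≤m*m+n*n : ∀ m n → m * n * 2 ≤ m * m + n * n
m*n*2≤m*m+n*n m n with ≤-total m n
... | inj₁ m≤n with m≤n⇒∃[o]m+o≡n m≤n
...   | t , refl = ≤-via (t * t) (solve (m ∷ t ∷ []))
m*n*2≤m*m+n*n m n | inj₂ n≤m with m≤n⇒∃[o]m+o≡n n≤m
...   | t , refl = ≤-via (t * t) (solve (n ∷ t ∷ []))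

a*b*k≡a²+b²+w⇒3≤k : ∀ {a b w} k .{{_ : NonZero w}} → a * b * k ≡ a * a + b * b + w → 3 ≤ k
a*b*k≡a²+b²+w⇒3≤k {a} {b} {w} k eq with 3 ≤? k
... | yes 3≤k = 3≤k
... | no 3≰k = ⊥-elim (<-irrefl eq (begin-strict
  a * b * k     ≤⟨ *-monoʳ-≤ (a * b) (≤-pred (≰⇒> 3≰k)) ⟩
  a * b * 2     ≤⟨ m*n*2≤m*m+n*n a b ⟩
  a * a + b * b <⟨ m<m+n (a * a + b * b) (>-nonZero⁻¹ w) ⟩
  a * a + b * b + w ∎))
  where open ≤-Reasoning

larger-square-bound : ∀ m n w k → .{{_ : NonZero m}} → 1 ≤ k → m ≤ n →
  m * n * (2 + k) ≡ m * m + n * n + w → n * n ≤ m * m + w → k * (m * n) ≤ 2 * w × n * n ≤ 3 * w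
larger-square-bound m n w k 1≤k m≤n eq n²≤ with m≤n⇒∃[o]m+o≡n m≤n
... | t , refl = k*mn≤2w , (begin
  (m + t) * (m + t) ≤⟨ n²≤ ⟩
  m * m + w         ≤⟨ +-monoˡ-≤ w m²≤2w ⟩
  2 * w + w         ≡⟨ solve (w ∷ []) ⟩
  3 * w             ∎)
  where
  open ≤-Reasoning
  t²≤w : t * t ≤ w
  t²≤w = ≤-trans (m≤n+m (t * t) (2 * m * t)) (+-cancelˡ-≤ (m * m) _ _ (begin
    m * m + (2 * m * t + t * t) ≡⟨ solve (m ∷ t ∷ []) ⟩
    (m + t) * (m + t)           ≤⟨ n²≤ ⟩
    m * m + w                   ∎))
  k*mn≤2w : k * (m * (m + t)) ≤ 2 * w
  k*mn≤2w = begin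
    k * (m * (m + t)) ≡⟨ combine 1 eq (solve (m ∷ t ∷ w ∷ k ∷ [])) ⟩
    t * t + w         ≤⟨ +-monoˡ-≤ w t²≤w ⟩
    w + w             ≡⟨ solve (w ∷ []) ⟩
    2 * w             ∎
  m²≤2w : m * m ≤ 2 * w
  m²≤2w = begin
    m * m             ≤⟨ *-monoʳ-≤ m (m≤m+n m t) ⟩
    m * (m + t)       ≤⟨ m≤n*m (m * (m + t)) k {{>-nonZero 1≤k}} ⟩
    k * (m * (m + t)) ≤⟨ k*mn≤2w ⟩
    2 * w             ∎

record MaxBound (a b w : ℕ) : Set where
  field
    M : ℕ
    a≤M : a ≤ M
    b≤M : b ≤ M
    M≤ab : M ≤ a * b
    M²≤3w : M * M ≤ 3 * w

max-bound : ∀ a b w k → .{{_ : NonZero a}} → .{{_ : NonZero b}} → 1 ≤ k →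
  a * b * (2 + k) ≡ a * a + b * b + w → a * a ≤ b * b + w → b * b ≤ a * a + w →
  k * (a * b) ≤ 2 * w × MaxBound a b w
max-bound a b w k 1≤k eq a²≤ b²≤ with ≤-total a b
... | inj₁ a≤b = proj₁ bounds , record
  { M = b ; a≤M = a≤b ; b≤M = ≤-refl ; M≤ab = m≤n*m b a ; M²≤3w = proj₂ bounds }
  where bounds = larger-square-bound a b w k 1≤k a≤b eq b²≤
... | inj₂ b≤a = subst (_≤ 2 * w) (cong (k *_) (*-comm b a)) (proj₁ bounds) , record
  { M = a ; a≤M = ≤-refl ; b≤M = b≤a ; M≤ab = m≤m*n a b ; M²≤3w = proj₂ bounds }
  where bounds = larger-square-bound b a w k 1≤k b≤a (combine 1 eq (solve (a ∷ b ∷ w ∷ k ∷ []))) a²≤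

d²≤M*[c+1] : ∀ {a b c d M} → a ≤ M → b ≤ M → d * d ≤ a * c + b → d * d ≤ M * (c + 1)
d²≤M*[c+1] {a} {b} {c} {d} {M} a≤M b≤M d²≤ = begin
  d * d         ≤⟨ d²≤ ⟩
  a * c + b     ≤⟨ +-mono-≤ (*-monoˡ-≤ c a≤M) b≤M ⟩
  M * c + M     ≡⟨ solve (M ∷ c ∷ []) ⟩
  M * (c + 1)   ∎
  where open ≤-Reasoning

k*d≤2c[c+1] : ∀ {a b c d k M} → .{{_ : NonZero d}} → d * d ≤ M * (c + 1) → M ≤ a * b →
              k * (a * b) ≤ 2 * (c * d) → k * d ≤ 2 * (c * (c + 1))
k*d≤2c[c+1] {a} {b} {c} {d} {k} {M} d²≤ M≤ab kab≤ = *-cancelˡ-≤ d (begin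
  d * (k * d)            ≡⟨ solve (d ∷ k ∷ []) ⟩
  k * (d * d)            ≤⟨ *-monoʳ-≤ k d²≤ ⟩
  k * (M * (c + 1))      ≤⟨ *-monoʳ-≤ k (*-monoˡ-≤ (c + 1) M≤ab) ⟩
  k * (a * b * (c + 1))  ≡⟨ solve (k ∷ a ∷ b ∷ c ∷ []) ⟩
  k * (a * b) * (c + 1)  ≤⟨ *-monoˡ-≤ (c + 1) kab≤ ⟩
  2 * (c * d) * (c + 1)  ≡⟨ solve (c ∷ d ∷ []) ⟩
  d * (2 * (c * (c + 1))) ∎)
  where open ≤-Reasoning

-- d⁴ ≤ M² (c + 1)² ≤ 3 c d (c + 1)², so d³ ≤ 12 c³ < (3 c)³.
d<3c : ∀ {c d M} → .{{_ : NonZero c}} → .{{_ : NonZero d}} → d * d ≤ M * (c + 1) → M * M ≤ 3 * (c * d) → d < 3 * c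
d<3c {c} {d} {M} d²≤ M²≤ with 3 * c ≤? d
... | no 3c≰d = ≰⇒> 3c≰d
... | yes 3c≤d = ⊥-elim (<⇒≱ (m<m+n (3 * c * ((c + c) * (c + c))) (>-nonZero⁻¹ (15 * (c * c * c)) {{c³≢0}}))
      (begin
        3 * c * ((c + c) * (c + c)) + 15 * (c * c * c) ≡⟨ solve (c ∷ []) ⟩
        3 * c * (3 * c) * (3 * c)                     ≤⟨ *-mono-≤ (*-mono-≤ 3c≤d 3c≤d) 3c≤d ⟩
        d * d * d                                     ≤⟨ d³≤ ⟩
        3 * c * ((c + 1) * (c + 1))                   ≤⟨ *-monoʳ-≤ (3 * c) (*-mono-≤ c+1≤c+c c+1≤c+c) ⟩
        3 * c * ((c + c) * (c + c))                   ∎))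
  where
  open ≤-Reasoning
  c³≢0 : NonZero (15 * (c * c * c))
  c³≢0 = m*n≢0 15 _ {{_}} {{m*n≢0 (c * c) c {{m*n≢0 c c}}}}
  c+1≤c+c : c + 1 ≤ c + c
  c+1≤c+c = +-monoʳ-≤ c (>-nonZero⁻¹ c)
  d³≤ : d * d * d ≤ 3 * c * ((c + 1) * (c + 1))
  d³≤ = *-cancelˡ-≤ d (begin
    d * (d * d * d)                   ≡⟨ solve (d ∷ []) ⟩
    (d * d) * (d * d)                 ≤⟨ *-mono-≤ d²≤ d²≤ ⟩
    (M * (c + 1)) * (M * (c + 1))     ≡⟨ solve (M ∷ c ∷ []) ⟩
    (M * M) * ((c + 1) * (c + 1))     ≤⟨ *-monoˡ-≤ ((c + 1) * (c + 1)) M²≤ ⟩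
    3 * (c * d) * ((c + 1) * (c + 1)) ≡⟨ solve (c ∷ d ∷ []) ⟩
    d * (3 * c * ((c + 1) * (c + 1))) ∎)

7c²≤4c²+12c+1⇒c<5 : ∀ c → 7 * (c * c) ≤ 4 * (c * c) + 12 * c + 1 → c < 5
7c²≤4c²+12c+1⇒c<5 c le with 5 ≤? c
... | no 5≰c = ≰⇒> 5≰c
... | yes 5≤c with m≤n⇒∃[o]m+o≡n 5≤c
...   | t , refl = ⊥-elim (<⇒≱ (m<m+n _ z<s) (begin
  4 * ((5 + t) * (5 + t)) + 12 * (5 + t) + 1 + (14 + 18 * t + 3 * (t * t)) ≡⟨ solve (t ∷ []) ⟩
  7 * ((5 + t) * (5 + t))                                                 ≤⟨ le ⟩
  4 * ((5 + t) * (5 + t)) + 12 * (5 + t) + 1                              ∎))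
  where open ≤-Reasoning

c<5 : ∀ {c d k} → c ≤ d → d < 3 * c → k * d ≤ 2 * (c * (c + 1)) →
      c * c + d * d + 1 + (2 + k) * (c + d) ≡ 9 * (c * d) → c < 5
c<5 {c} {d} {k} c≤d d<3c kd≤ T≡0 with m≤n⇒∃[o]m+o≡n c≤d
... | s , refl = 7c²≤4c²+12c+1⇒c<5 c (begin
  7 * (c * c)                                      ≤⟨ 7c²≤ ⟩
  (2 + k) * (c + (c + s)) + 1                      ≡⟨ solve (c ∷ s ∷ k ∷ []) ⟩
  2 * c + 2 * (c + s) + (k * c + k * (c + s)) + 1  ≤⟨ +-monoˡ-≤ 1 (+-mono-≤ (+-monoʳ-≤ (2 * c) (*-monoʳ-≤ 2 (<⇒≤ d<3c)))
                                                        (+-mono-≤ (≤-trans (*-monoʳ-≤ k c≤d) kd≤) kd≤)) ⟩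
  2 * c + 2 * (3 * c) + (2 * (c * (c + 1)) + 2 * (c * (c + 1))) + 1 ≡⟨ solve (c ∷ []) ⟩
  4 * (c * c) + 12 * c + 1                         ∎)
  where
  open ≤-Reasoning
  s≤2c : s ≤ 2 * c
  s≤2c = +-cancelˡ-≤ c s (2 * c) (≤-trans (<⇒≤ d<3c) (≤-reflexive (solve (c ∷ []))))
  s²≤7cs : s * s ≤ 7 * (c * s)
  s²≤7cs = begin
    s * s         ≤⟨ *-monoˡ-≤ s (≤-trans s≤2c (*-monoˡ-≤ c (s≤s (s≤s (z≤n {5}))))) ⟩
    7 * c * s     ≡⟨ *-assoc 7 c s ⟩
    7 * (c * s)   ∎
  7c²≤ : 7 * (c * c) ≤ (2 + k) * (c + (c + s)) + 1
  7c²≤ = +-cancelʳ-≤ (7 * (c * s)) _ _ (begin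
    7 * (c * c) + 7 * (c * s)                 ≡⟨ combine 1 T≡0 (solve (c ∷ s ∷ k ∷ [])) ⟨
    (2 + k) * (c + (c + s)) + 1 + s * s       ≤⟨ +-monoʳ-≤ ((2 + k) * (c + (c + s)) + 1) s²≤7cs ⟩
    (2 + k) * (c + (c + s)) + 1 + 7 * (c * s) ∎)

m*m≤132⇒m<12 : ∀ m → m * m ≤ 132 → m < 12
m*m≤132⇒m<12 m le with 12 ≤? m
... | no 12≰m = ≰⇒> 12≰m
... | yes 12≤m = ⊥-elim (<⇒≱ (from-yes (132 <? 144)) (≤-trans (*-mono-≤ 12≤m 12≤m) le))

UnitCase : ℕ → ℕ → ℕ → ℕ → ℕ → Set
UnitCase c d k a b = a * b * (2 + k) ≡ a * a + b * b + c * d →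
  a * a ≤ b * b + c * d → b * b ≤ a * a + c * d → d * d ≤ a * c + b →
  k * (a * b) ≤ 2 * (c * d) → k * d ≤ 2 * (c * (c + 1)) → AllOne a b c d

SmallCase : ℕ → ℕ → ℕ → Set
SmallCase c d k = c ≤ d → c * c + d * d + 1 + (2 + k) * (c + d) ≡ 9 * (c * d) →
  ∀ {a} → a < 12 → ∀ {b} → b < 12 → UnitCase c d k a b

small-case? : ∀ c d k → Dec (SmallCase c d k)
small-case? c d k = (c ≤? d) →-dec ((_ ≟ _) →-dec allUpTo? (λ a → allUpTo? (λ b → unit-case? a b) 12) 12)
  where
  unit-case? : ∀ a b → Dec (UnitCase c d k a b)
  unit-case? a b = (_ ≟ _) →-dec ((_ ≤? _) →-dec ((_ ≤? _) →-dec ((_ ≤? _) →-dec ((_ ≤? _) →-dec ((_ ≤? _) →-dec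
    ((a ≟ 1) ×-dec ((b ≟ 1) ×-dec ((c ≟ 1) ×-dec (d ≟ 1)))))))))

small-cases : ∀ {c} → c < 5 → ∀ {d} → d < 12 → ∀ {k} → k < 11 → SmallCase c d k
small-cases = from-yes (allUpTo? (λ c → allUpTo? (λ d → allUpTo? (small-case? c d) 11) 12) 5)

-- k₁ ≥ 3 by AM-GM; writing k₁ = 3 + k, the bounds below leave a finite search.
minimal-c≤d⇒all-one : ∀ {a b c d} → Admissible a b c d → c ≤ d →
  a * a ≤ b * b + c * d → b * b ≤ a * a + c * d → d * d ≤ a * c + b → AllOne a b c d
minimal-c≤d⇒all-one {a} {b} {c} {d} (mkAdmissible k₁ _ _ φ₁≡k₁ _ _ T≡0 {{_}} {{_}} {{_}} {{_}})
  c≤d a²≤ b²≤ d²≤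
  with m≤n⇒∃[o]m+o≡n (a*b*k≡a²+b²+w⇒3≤k {a} {b} {c * d} k₁ {{m*n≢0 c d}} φ₁≡k₁)
... | k , refl = small-cases (s≤s c≤4) d<12 k<11 c≤d T≡0 a<12 b<12 φ₁≡k₁ a²≤ b²≤ d²≤ kab≤ kd≤
  where
  bounds = max-bound a b (c * d) (suc k) (s≤s z≤n) φ₁≡k₁ a²≤ b²≤
  kab≤ = proj₁ bounds
  open MaxBound (proj₂ bounds)
  d²≤M[c+1] : d * d ≤ M * (c + 1)
  d²≤M[c+1] = d²≤M*[c+1] {a} {b} {c} {d} a≤M b≤M d²≤
  kd≤ : suc k * d ≤ 2 * (c * (c + 1))
  kd≤ = k*d≤2c[c+1] {a} {b} {c} {d} {suc k} d²≤M[c+1] M≤ab kab≤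
  d<3c′ : d < 3 * c
  d<3c′ = d<3c {c} {d} {M} d²≤M[c+1] M²≤3w
  c≤4 : c ≤ 4
  c≤4 = ≤-pred (c<5 {c} {d} {suc k} c≤d d<3c′ kd≤ T≡0)
  d<12 : d < 12
  d<12 = <-≤-trans d<3c′ (*-monoʳ-≤ 3 c≤4)
  k<11 : suc k < 11
  k<11 = s≤s (≤-trans (*-cancelʳ-≤ (suc k) (2 * (c + 1)) c (begin
    suc k * c         ≤⟨ *-monoʳ-≤ (suc k) c≤d ⟩
    suc k * d         ≤⟨ kd≤ ⟩
    2 * (c * (c + 1)) ≡⟨ solve (c ∷ []) ⟩
    2 * (c + 1) * c   ∎)) (*-monoʳ-≤ 2 (+-monoˡ-≤ 1 c≤4)))
    where open ≤-Reasoning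
  M<12 : M < 12
  M<12 = m*m≤132⇒m<12 M (≤-trans M²≤3w (*-monoʳ-≤ 3 (*-mono-≤ c≤4 (≤-pred d<12))))
  a<12 = ≤-<-trans a≤M M<12
  b<12 = ≤-<-trans b≤M M<12

minimal⇒all-one : ∀ {a b c d} → Admissible a b c d →
  a * a ≤ b * b + c * d → b * b ≤ a * a + c * d → d * d ≤ a * c + b → c * c ≤ b * d + a → AllOne a b c d
minimal⇒all-one {a} {b} {c} {d} A a²≤ b²≤ d²≤ c²≤ with ≤-total c d
... | inj₁ c≤d = minimal-c≤d⇒all-one A c≤d a²≤ b²≤ d²≤
... | inj₂ d≤c =
  let b≡1 , a≡1 , d≡1 , c≡1 = minimal-c≤d⇒all-one (admissible-swap A) d≤c
                                 (subst (b * b ≤_) (cong (a * a +_) (*-comm c d)) b²≤)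
                                 (subst (a * a ≤_) (cong (b * b +_) (*-comm c d)) a²≤) c²≤
  in a≡1 , b≡1 , c≡1 , d≡1

data Descent (a b c d : ℕ) : Set where
  at-one   : AllOne a b c d → Descent a b c d
  down-α   : ∀ x → a * x ≡ b * b + c * d → Admissible b x c d → x < a → Descent a b c d
  down-α⁻¹ : ∀ y → b * y ≡ a * a + c * d → Admissible y a c d → y < b → Descent a b c d
  down-β   : ∀ x → d * x ≡ a * c + b → Admissible b c x a → x < d → Descent a b c d
  down-β⁻¹ : ∀ y → c * y ≡ b * d + a → Admissible d a b y → y < c → Descent a b c d

m*n≡o<m*m⇒n<m : ∀ m n {o} → m * n ≡ o → o < m * m → n < m
m*n≡o<m*m⇒n<m m n refl = *-cancelˡ-< m n m

descent : ∀ {a b c d} → Admissible a b c d → Descent a b c d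
descent {a} {b} {c} {d} A with b * b + c * d <? a * a
... | yes lt = let x , ax≡ , A′ = admissible-α A in down-α x ax≡ A′ (m*n≡o<m*m⇒n<m a x ax≡ lt)
... | no a²≮ with a * a + c * d <? b * b
...   | yes lt = let y , by≡ , A′ = admissible-α⁻¹ A in down-α⁻¹ y by≡ A′ (m*n≡o<m*m⇒n<m b y by≡ lt)
...   | no b²≮ with a * c + b <? d * d
...     | yes lt = let x , dx≡ , A′ = admissible-β A in down-β x dx≡ A′ (m*n≡o<m*m⇒n<m d x dx≡ lt)
...     | no d²≮ with b * d + a <? c * c
...       | yes lt = let y , cy≡ , A′ = admissible-β⁻¹ A in down-β⁻¹ y cy≡ A′ (m*n≡o<m*m⇒n<m c y cy≡ lt)
...       | no c²≮ = at-one (minimal⇒all-one A (≮⇒≥ a²≮) (≮⇒≥ b²≮) (≮⇒≥ d²≮) (≮⇒≥ c²≮))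

shrink : ∀ {s t n x y} r → x < y → t < suc n → s ≡ x + r → t ≡ y + r → s < n
shrink r x<y t<1+n refl refl = <-≤-trans (+-monoˡ-< r x<y) (≤-pred t<1+n)

scale⇔ : ∀ X {L R L′ R′} .{{_ : NonZero X}} → L′ ≡ X * L → R′ ≡ X * R → (L′ ≡ R′ ⇔ L ≡ R)
scale⇔ X {L} {R} refl refl = mk⇔ (*-cancelˡ-≡ L R X) (cong (X *_))

T-numerator⇔ : ∀ {a b c d k} .{{_ : NonZero a}} .{{_ : NonZero b}} → a * b * k ≡ a * a + b * b + c * d →
  (a * b * c * d * 9 ≡ a * b * (c * c + d * d + 1) + (a * a + b * b + c * d) * (c + d)
    ⇔ c * c + d * d + 1 + k * (c + d) ≡ 9 * (c * d))
T-numerator⇔ {a} {b} {c} {d} {k} φ₁≡k = mk⇔ to from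
  where
  to : a * b * c * d * 9 ≡ a * b * (c * c + d * d + 1) + (a * a + b * b + c * d) * (c + d) →
       c * c + d * d + 1 + k * (c + d) ≡ 9 * (c * d)
  to T≡ = combine (a * b) {{m*n≢0 a b}} ((c + d) · φ₁≡k ⊕ sym T≡) (solve (a ∷ b ∷ c ∷ d ∷ k ∷ []))
  from : c * c + d * d + 1 + k * (c + d) ≡ 9 * (c * d) →
         a * b * c * d * 9 ≡ a * b * (c * c + d * d + 1) + (a * a + b * b + c * d) * (c + d)
  from T≡ = combine 1 ((a * b) · sym T≡ ⊕ (c + d) · φ₁≡k) (solve (a ∷ b ∷ c ∷ d ∷ k ∷ []))

-- Natural values of positive rationals

ℕtoℚ : ℕ → ℚ
ℕtoℚ n = ℤ.+ n ℚ./ 1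

ℕtoℚ≡mkℚ : ∀ n → ℕtoℚ n ≡ mkℚ (ℤ.+ n) 0 (Coprime.sym (Coprime.1-coprimeTo n))
ℕtoℚ≡mkℚ n = ℚ.↥p/↧p≡p (mkℚ (ℤ.+ n) 0 _)

ℕtoℚ-+ : ∀ m n → ℕtoℚ m ℚ.+ ℕtoℚ n ≡ ℕtoℚ (m + n)
ℕtoℚ-+ m n = trans (cong₂ ℚ._+_ (ℕtoℚ≡mkℚ m) (ℕtoℚ≡mkℚ n))
  (ℚ./-cong (trans (cong₂ ℤ._+_ (ℤ.*-identityʳ (ℤ.+ m)) (ℤ.*-identityʳ (ℤ.+ n))) (sym (ℤ.pos-+ m n))) refl)

ℕtoℚ-* : ∀ m n → ℕtoℚ m ℚ.* ℕtoℚ n ≡ ℕtoℚ (m * n)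
ℕtoℚ-* m n = trans (cong₂ ℚ._*_ (ℕtoℚ≡mkℚ m) (ℕtoℚ≡mkℚ n)) (ℚ./-cong (sym (ℤ.pos-* m n)) refl)

ℕtoℚ-injective : ∀ {m n} → ℕtoℚ m ≡ ℕtoℚ n → m ≡ n
ℕtoℚ-injective {m} {n} eq =
  ℤ.+-injective (proj₁ (ℚ.mkℚ-injective (trans (sym (ℕtoℚ≡mkℚ m)) (trans eq (ℕtoℚ≡mkℚ n)))))

p≡r*q⇒p*1/q≡r : ∀ p q r .{{_ : ℚ.NonZero q}} → p ≡ r ℚ.* q → p ℚ.* 1/ q ≡ r
p≡r*q⇒p*1/q≡r p q r refl = begin
  r ℚ.* q ℚ.* 1/ q   ≡⟨ ℚ.*-assoc r q (1/ q) ⟩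
  r ℚ.* (q ℚ.* 1/ q) ≡⟨ cong (r ℚ.*_) (ℚ.*-inverseʳ q) ⟩
  r ℚ.* ℚ.1ℚ         ≡⟨ ℚ.*-identityʳ r ⟩
  r                  ∎
  where open ≡-Reasoning

p*1/q≡r⇒p≡r*q : ∀ p q r .{{_ : ℚ.NonZero q}} → p ℚ.* 1/ q ≡ r → p ≡ r ℚ.* q
p*1/q≡r⇒p≡r*q p q r refl = begin
  p                    ≡⟨ ℚ.*-identityʳ p ⟨
  p ℚ.* ℚ.1ℚ           ≡⟨ cong (p ℚ.*_) (ℚ.*-inverseˡ q) ⟨
  p ℚ.* (1/ q ℚ.* q)   ≡⟨ ℚ.*-assoc p (1/ q) q ⟨
  p ℚ.* 1/ q ℚ.* q     ∎
  where open ≡-Reasoning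

ℚ-*-cancelˡ-≡ : ∀ p {q r} .{{_ : ℚ.NonZero p}} → p ℚ.* q ≡ p ℚ.* r → q ≡ r
ℚ-*-cancelˡ-≡ p {q} {r} eq = begin
  q                  ≡⟨ ℚ.*-identityˡ q ⟨
  ℚ.1ℚ ℚ.* q         ≡⟨ cong (ℚ._* q) (ℚ.*-inverseˡ p) ⟨
  1/ p ℚ.* p ℚ.* q   ≡⟨ ℚ.*-assoc (1/ p) p q ⟩
  1/ p ℚ.* (p ℚ.* q) ≡⟨ cong (1/ p ℚ.*_) eq ⟩
  1/ p ℚ.* (p ℚ.* r) ≡⟨ ℚ.*-assoc (1/ p) p r ⟨
  1/ p ℚ.* p ℚ.* r   ≡⟨ cong (ℚ._* r) (ℚ.*-inverseˡ p) ⟩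
  ℚ.1ℚ ℚ.* r         ≡⟨ ℚ.*-identityˡ r ⟩
  r                  ∎
  where open ≡-Reasoning

ℚ⁺-≡ : ∀ {x y : ℚ⁺} → val x ≡ val y → x ≡ y
ℚ⁺-≡ refl = refl

val≢0 : (x : ℚ⁺) → ℚ.NonZero (val x)
val≢0 (mk⁺ v v>0) = ℚ.pos⇒nonZero v {{v>0}}

/⁺-cancelˡ : ∀ x {y z} → x /⁺ y ≡ x /⁺ z → y ≡ z
/⁺-cancelˡ x {y} {z} eq = ℚ⁺-≡ (ℚ-*-cancelˡ-≡ (val (x /⁺ y)) {{val≢0 (x /⁺ y)}} (begin
  val (x /⁺ y) ℚ.* val y ≡⟨ p*1/q≡r⇒p≡r*q (val x) (val y) _ {{val≢0 y}} refl ⟨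
  val x                  ≡⟨ p*1/q≡r⇒p≡r*q (val x) (val z) _ {{val≢0 z}} (cong val (sym eq)) ⟩
  val (x /⁺ y) ℚ.* val z ∎))
  where open ≡-Reasoning

α-injective : ∀ {P Q} → α P ≡ α Q → P ≡ Q
α-injective {⟨ a , b , c , d , e ⟩} {⟨ a′ , b′ , c′ , d′ , e′ ⟩} eq
  with cong Pt.a eq | cong Pt.c eq | cong Pt.d eq | cong Pt.e eq
... | refl | refl | refl | refl = cong ⟨_, b , c , d , e ⟩ (/⁺-cancelˡ (b *⁺ b +⁺ c *⁺ d) (cong Pt.b eq))

β-injective : ∀ {P Q} → β P ≡ β Q → P ≡ Q
β-injective {⟨ a , b , c , d , e ⟩} {⟨ a′ , b′ , c′ , d′ , e′ ⟩} eq
  with cong Pt.d eq | cong Pt.a eq | cong Pt.b eq | cong Pt.e eq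
... | refl | refl | refl | refl = cong (λ x → ⟨ a , b , c , x , e ⟩) (/⁺-cancelˡ (a *⁺ c +⁺ b *⁺ e) (cong Pt.c eq))

infix 4 _≡ℕ⁺_

-- A record rather than val x ≡ℕ n, so that x can be inferred (val is not injective).
record _≡ℕ⁺_ (x : ℚ⁺) (n : ℕ) : Set where
  constructor val≡
  field
    val≡ℕ : val x ≡ℕ n

+-≡ℕ⁺ : ∀ {x y m n} → x ≡ℕ⁺ m → y ≡ℕ⁺ n → x +⁺ y ≡ℕ⁺ m + n
+-≡ℕ⁺ {m = m} {n} (val≡ x≡m) (val≡ y≡n) = val≡ (trans (cong₂ ℚ._+_ x≡m y≡n) (ℕtoℚ-+ m n))

*-≡ℕ⁺ : ∀ {x y m n} → x ≡ℕ⁺ m → y ≡ℕ⁺ n → x *⁺ y ≡ℕ⁺ m * n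
*-≡ℕ⁺ {m = m} {n} (val≡ x≡m) (val≡ y≡n) = val≡ (trans (cong₂ ℚ._*_ x≡m y≡n) (ℕtoℚ-* m n))

/-≡ℕ⁺ : ∀ {x y N D} k → x ≡ℕ⁺ N → y ≡ℕ⁺ D → (val (x /⁺ y) ≡ℕ k ⇔ D * k ≡ N)
/-≡ℕ⁺ {x} {y} {N} {D} k (val≡ x≡N) (val≡ y≡D) = mk⇔
  (λ x/y≡k → ℕtoℚ-injective (begin
    ℕtoℚ (D * k)       ≡⟨ cong ℕtoℚ (*-comm D k) ⟩
    ℕtoℚ (k * D)       ≡⟨ ℕtoℚ-* k D ⟨
    ℕtoℚ k ℚ.* ℕtoℚ D    ≡⟨ cong₂ ℚ._*_ x/y≡k y≡D ⟨
    val (x /⁺ y) ℚ.* val y ≡⟨ p*1/q≡r⇒p≡r*q (val x) (val y) _ {{val≢0 y}} refl ⟨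
    val x                ≡⟨ x≡N ⟩
    ℕtoℚ N               ∎))
  (λ Dk≡N → p≡r*q⇒p*1/q≡r (val x) (val y) (ℕtoℚ k) {{val≢0 y}} (begin
    val x             ≡⟨ x≡N ⟩
    ℕtoℚ N            ≡⟨ cong ℕtoℚ (trans (sym Dk≡N) (*-comm D k)) ⟩
    ℕtoℚ (k * D)    ≡⟨ ℕtoℚ-* k D ⟨
    ℕtoℚ k ℚ.* ℕtoℚ D ≡⟨ cong (ℕtoℚ k ℚ.*_) y≡D ⟨
    ℕtoℚ k ℚ.* val y  ∎))
  where open ≡-Reasoning

≡ℕ⁺⇒≢0 : ∀ {x n} → x ≡ℕ⁺ n → NonZero n
≡ℕ⁺⇒≢0 {mk⁺ _ x>0} {n} (val≡ refl) = positive⇒≢0 n x>0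
  where
  positive⇒≢0 : ∀ n → .(ℚ.Positive (ℕtoℚ n)) → NonZero n
  positive⇒≢0 (suc n) _ = _

-- The points ε · (a, b, c, d, 1)

Pt-≡ : ∀ {P Q} → Pt.a P ≡ Pt.a Q → Pt.b P ≡ Pt.b Q → Pt.c P ≡ Pt.c Q → Pt.d P ≡ Pt.d Q → Pt.e P ≡ Pt.e Q → P ≡ Q
Pt-≡ {⟨ _ , _ , _ , _ , _ ⟩} {⟨ _ , _ , _ , _ , _ ⟩} refl refl refl refl refl = refl

record Scaled (ε a b c d : ℕ) (P : Pt) : Set where
  constructor scaled
  field
    a≡ : Pt.a P ≡ℕ⁺ a * ε
    b≡ : Pt.b P ≡ℕ⁺ b * ε
    c≡ : Pt.c P ≡ℕ⁺ c * ε
    d≡ : Pt.d P ≡ℕ⁺ d * ε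
    e≡ : Pt.e P ≡ℕ⁺ ε

module _ (ε : ℕ) .{{_ : NonZero ε}} where

  scaledPt : ∀ {a b c d} → Admissible a b c d → Pt
  scaledPt {a} {b} {c} {d} A = ⟨ ℕ⁺ (a * ε) {{m*n≢0 a ε}} , ℕ⁺ (b * ε) {{m*n≢0 b ε}} ,
                                 ℕ⁺ (c * ε) {{m*n≢0 c ε}} , ℕ⁺ (d * ε) {{m*n≢0 d ε}} , ℕ⁺ ε ⟩
    where open Admissible A

  scaledPt-scaled : ∀ {a b c d} (A : Admissible a b c d) → Scaled ε a b c d (scaledPt A)
  scaledPt-scaled A = scaled (val≡ refl) (val≡ refl) (val≡ refl) (val≡ refl) (val≡ refl)

  scaled⇒≡scaledPt : ∀ {a b c d P} → Scaled ε a b c d P → (A : Admissible a b c d) → P ≡ scaledPt A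
  scaled⇒≡scaledPt (scaled (val≡ a≡) (val≡ b≡) (val≡ c≡) (val≡ d≡) (val≡ e≡)) A =
    Pt-≡ (ℚ⁺-≡ a≡) (ℚ⁺-≡ b≡) (ℚ⁺-≡ c≡) (ℚ⁺-≡ d≡) (ℚ⁺-≡ e≡)

  scaledPt-one : (A : Admissible 1 1 1 1) → scaledPt A ≡ diag ε
  scaledPt-one A = sym (scaled⇒≡scaledPt (scaled one one one one (val≡ refl)) A)
    where
    one : ℕ⁺ ε ≡ℕ⁺ 1 * ε
    one = val≡ (cong ℕtoℚ (sym (*-identityˡ ε)))

  α-scaledPt : ∀ {a b c d x} → a * x ≡ b * b + c * d → (A : Admissible a b c d) (A′ : Admissible b x c d) →
               α (scaledPt A) ≡ scaledPt A′
  α-scaledPt {a} {b} {c} {d} {x} ax≡ A A′ =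
    scaled⇒≡scaledPt (scaled (val≡ refl) x≡ (val≡ refl) (val≡ refl) (val≡ refl)) A′
    where
    x≡ : Pt.b (α (scaledPt A)) ≡ℕ⁺ x * ε
    x≡ = let scaled a≡ b≡ c≡ d≡ _ = scaledPt-scaled A in
      val≡ (Equivalence.from (/-≡ℕ⁺ (x * ε) (+-≡ℕ⁺ (*-≡ℕ⁺ b≡ b≡) (*-≡ℕ⁺ c≡ d≡)) a≡)
        (combine 1 ((ε * ε) · ax≡) (solve (a ∷ b ∷ c ∷ d ∷ x ∷ ε ∷ []))))

  β-scaledPt : ∀ {a b c d x} → d * x ≡ a * c + b → (A : Admissible a b c d) (A′ : Admissible b c x a) →
               β (scaledPt A) ≡ scaledPt A′
  β-scaledPt {a} {b} {c} {d} {x} dx≡ A A′ =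
    scaled⇒≡scaledPt (scaled (val≡ refl) (val≡ refl) x≡ (val≡ refl) (val≡ refl)) A′
    where
    x≡ : Pt.c (β (scaledPt A)) ≡ℕ⁺ x * ε
    x≡ = let scaled a≡ b≡ c≡ d≡ e≡ = scaledPt-scaled A in
      val≡ (Equivalence.from (/-≡ℕ⁺ (x * ε) (+-≡ℕ⁺ (*-≡ℕ⁺ a≡ c≡) (*-≡ℕ⁺ b≡ e≡)) d≡)
        (combine 1 ((ε * ε) · dx≡) (solve (a ∷ b ∷ c ∷ d ∷ x ∷ ε ∷ []))))

  record ScaledAdmissible (P : Pt) : Set where
    constructor scaled-admissible
    field
      {a b c d} : ℕ
      admissible : Admissible a b c d
      ≡scaledPt : P ≡ scaledPt admissible

  α-closed : ∀ {P} → ScaledAdmissible P → ScaledAdmissible (α P)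
  α-closed (scaled-admissible A refl) =
    let _ , ax≡ , A′ = admissible-α A in scaled-admissible A′ (α-scaledPt ax≡ A A′)

  β-closed : ∀ {P} → ScaledAdmissible P → ScaledAdmissible (β P)
  β-closed (scaled-admissible A refl) =
    let _ , dx≡ , A′ = admissible-β A in scaled-admissible A′ (β-scaledPt dx≡ A A′)

  α⁻¹-closed : ∀ {P} → ScaledAdmissible (α P) → ScaledAdmissible P
  α⁻¹-closed (scaled-admissible {b = b} A αP≡) =
    let y , by≡ , A′ = admissible-α⁻¹ A in
    scaled-admissible A′ (α-injective (trans αP≡ (sym (α-scaledPt (trans (*-comm y b) by≡) A′ A))))

  β⁻¹-closed : ∀ {P} → ScaledAdmissible (β P) → ScaledAdmissible P
  β⁻¹-closed (scaled-admissible {a} {b} {c} {d} A βP≡) =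
    let y , cy≡ , A′ = admissible-β⁻¹ A in
    scaled-admissible A′ (β-injective (trans βP≡ (sym (β-scaledPt
      (trans (*-comm y c) (trans cy≡ (cong (_+ a) (*-comm b d)))) A′ A))))

  orbit⇒scaled-admissible : ∀ {P} → Orbit (diag ε) P → ScaledAdmissible P
  orbit⇒scaled-admissible here = scaled-admissible admissible-1111 (sym (scaledPt-one admissible-1111))
  orbit⇒scaled-admissible (by-α o) = α-closed (orbit⇒scaled-admissible o)
  orbit⇒scaled-admissible (by-β o) = β-closed (orbit⇒scaled-admissible o)
  orbit⇒scaled-admissible (by-α⁻ o) = α⁻¹-closed (orbit⇒scaled-admissible o)
  orbit⇒scaled-admissible (by-β⁻ o) = β⁻¹-closed (orbit⇒scaled-admissible o)

  orbit-of-admissible : ∀ n {a b c d} (A : Admissible a b c d) → a + b + c + d < n → Orbit (diag ε) (scaledPt A)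
  orbit-of-admissible (suc n) {a} {b} {c} {d} A s<n with descent A
  ... | at-one (refl , refl , refl , refl) = subst (Orbit (diag ε)) (sym (scaledPt-one A)) here
  ... | down-α x ax≡ A′ x<a = by-α⁻ (subst (Orbit (diag ε)) (sym (α-scaledPt ax≡ A A′))
    (orbit-of-admissible n A′ (shrink {b + x + c + d} (b + c + d) x<a s<n
      (solve (b ∷ x ∷ c ∷ d ∷ [])) (solve (a ∷ b ∷ c ∷ d ∷ [])))))
  ... | down-α⁻¹ y by≡ A′ y<b = subst (Orbit (diag ε)) (α-scaledPt (trans (*-comm y b) by≡) A′ A)
    (by-α (orbit-of-admissible n A′ (shrink {y + a + c + d} (a + c + d) y<b s<n
      (solve (y ∷ a ∷ c ∷ d ∷ [])) (solve (a ∷ b ∷ c ∷ d ∷ [])))))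
  ... | down-β x dx≡ A′ x<d = by-β⁻ (subst (Orbit (diag ε)) (sym (β-scaledPt dx≡ A A′))
    (orbit-of-admissible n A′ (shrink {b + c + x + a} (a + b + c) x<d s<n
      (solve (a ∷ b ∷ c ∷ x ∷ [])) (solve (a ∷ b ∷ c ∷ d ∷ [])))))
  ... | down-β⁻¹ y cy≡ A′ y<c = subst (Orbit (diag ε))
    (β-scaledPt (trans (*-comm y c) (trans cy≡ (cong (_+ a) (*-comm b d)))) A′ A)
    (by-β (orbit-of-admissible n A′ (shrink {d + a + b + y} (a + b + d) y<c s<n
      (solve (d ∷ a ∷ b ∷ y ∷ [])) (solve (a ∷ b ∷ c ∷ d ∷ [])))))

  scaled-admissible⇒orbit : ∀ {P} → ScaledAdmissible P → Orbit (diag ε) P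
  scaled-admissible⇒orbit (scaled-admissible A refl) = orbit-of-admissible _ A (n<1+n _)

  φ₁≡ℕ⇔ : ∀ {a b c d P} → Scaled ε a b c d P → ∀ k → φ₁ P ≡ℕ k ⇔ a * b * k ≡ a * a + b * b + c * d
  φ₁≡ℕ⇔ {a} {b} {c} {d} (scaled a≡ b≡ c≡ d≡ _) k = ⇔-trans
    (/-≡ℕ⁺ k (+-≡ℕ⁺ (+-≡ℕ⁺ (*-≡ℕ⁺ a≡ a≡) (*-≡ℕ⁺ b≡ b≡)) (*-≡ℕ⁺ c≡ d≡)) (*-≡ℕ⁺ a≡ b≡))
    (scale⇔ (ε * ε) {{m*n≢0 ε ε}} lhs rhs)
    where
    lhs : a * ε * (b * ε) * k ≡ ε * ε * (a * b * k)
    lhs = solve (a ∷ b ∷ k ∷ ε ∷ [])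
    rhs : a * ε * (a * ε) + b * ε * (b * ε) + c * ε * (d * ε) ≡ ε * ε * (a * a + b * b + c * d)
    rhs = solve (a ∷ b ∷ c ∷ d ∷ ε ∷ [])

  φ₂≡ℕ⇔ : ∀ {a b c d P} → Scaled ε a b c d P → ∀ k →
          φ₂ P ≡ℕ k ⇔ b * c * d * k ≡ c * c * d + a * a * c + b * b * d + a * b
  φ₂≡ℕ⇔ {a} {b} {c} {d} (scaled a≡ b≡ c≡ d≡ e≡) k = ⇔-trans
    (/-≡ℕ⁺ k (+-≡ℕ⁺ (+-≡ℕ⁺ (+-≡ℕ⁺ (*-≡ℕ⁺ (*-≡ℕ⁺ c≡ c≡) d≡) (*-≡ℕ⁺ (*-≡ℕ⁺ a≡ a≡) c≡)) (*-≡ℕ⁺ (*-≡ℕ⁺ b≡ b≡) d≡))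
                    (*-≡ℕ⁺ (*-≡ℕ⁺ a≡ b≡) e≡))
             (*-≡ℕ⁺ (*-≡ℕ⁺ b≡ c≡) d≡))
    (scale⇔ (ε * ε * ε) {{m*n≢0 (ε * ε) ε {{m*n≢0 ε ε}}}} lhs rhs)
    where
    lhs : b * ε * (c * ε) * (d * ε) * k ≡ ε * ε * ε * (b * c * d * k)
    lhs = solve (b ∷ c ∷ d ∷ k ∷ ε ∷ [])
    rhs : c * ε * (c * ε) * (d * ε) + a * ε * (a * ε) * (c * ε) + b * ε * (b * ε) * (d * ε) + a * ε * (b * ε) * ε
          ≡ ε * ε * ε * (c * c * d + a * a * c + b * b * d + a * b)
    rhs = solve (a ∷ b ∷ c ∷ d ∷ ε ∷ [])

  φ₃≡ℕ⇔ : ∀ {a b c d P} → Scaled ε a b c d P → ∀ k →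
          φ₃ P ≡ℕ k ⇔ a * c * d * k ≡ c * d * d + a * a * c + b * b * d + a * b
  φ₃≡ℕ⇔ {a} {b} {c} {d} (scaled a≡ b≡ c≡ d≡ e≡) k = ⇔-trans
    (/-≡ℕ⁺ k (+-≡ℕ⁺ (+-≡ℕ⁺ (+-≡ℕ⁺ (*-≡ℕ⁺ (*-≡ℕ⁺ c≡ d≡) d≡) (*-≡ℕ⁺ (*-≡ℕ⁺ a≡ a≡) c≡)) (*-≡ℕ⁺ (*-≡ℕ⁺ b≡ b≡) d≡))
                    (*-≡ℕ⁺ (*-≡ℕ⁺ a≡ b≡) e≡))
             (*-≡ℕ⁺ (*-≡ℕ⁺ a≡ c≡) d≡))
    (scale⇔ (ε * ε * ε) {{m*n≢0 (ε * ε) ε {{m*n≢0 ε ε}}}} lhs rhs)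
    where
    lhs : a * ε * (c * ε) * (d * ε) * k ≡ ε * ε * ε * (a * c * d * k)
    lhs = solve (a ∷ c ∷ d ∷ k ∷ ε ∷ [])
    rhs : c * ε * (d * ε) * (d * ε) + a * ε * (a * ε) * (c * ε) + b * ε * (b * ε) * (d * ε) + a * ε * (b * ε) * ε
          ≡ ε * ε * ε * (c * d * d + a * a * c + b * b * d + a * b)
    rhs = solve (a ∷ b ∷ c ∷ d ∷ ε ∷ [])

  T≡0⇔ : ∀ {a b c d P} → Scaled ε a b c d P →
         T P ≡ 0ℚ ⇔ a * b * c * d * 9 ≡ a * b * (c * c + d * d + 1) + (a * a + b * b + c * d) * (c + d)
  T≡0⇔ {a} {b} {c} {d} (scaled a≡ b≡ c≡ d≡ e≡) = ⇔-trans
    (mk⇔ (x∙y⁻¹≈ε⇒x≈y _ _) x≈y⇒x∙y⁻¹≈ε)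
    (⇔-trans
      (/-≡ℕ⁺ 9 (+-≡ℕ⁺ (*-≡ℕ⁺ (*-≡ℕ⁺ a≡ b≡) (+-≡ℕ⁺ (+-≡ℕ⁺ (*-≡ℕ⁺ c≡ c≡) (*-≡ℕ⁺ d≡ d≡)) (*-≡ℕ⁺ e≡ e≡)))
                      (*-≡ℕ⁺ (*-≡ℕ⁺ (+-≡ℕ⁺ (+-≡ℕ⁺ (*-≡ℕ⁺ a≡ a≡) (*-≡ℕ⁺ b≡ b≡)) (*-≡ℕ⁺ c≡ d≡)) (+-≡ℕ⁺ c≡ d≡)) e≡))
               (*-≡ℕ⁺ (*-≡ℕ⁺ (*-≡ℕ⁺ a≡ b≡) c≡) d≡))
      (scale⇔ (ε * ε * ε * ε) {{m*n≢0 (ε * ε * ε) ε {{m*n≢0 (ε * ε) ε {{m*n≢0 ε ε}}}}}} lhs rhs))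
    where
    lhs : a * ε * (b * ε) * (c * ε) * (d * ε) * 9 ≡ ε * ε * ε * ε * (a * b * c * d * 9)
    lhs = solve (a ∷ b ∷ c ∷ d ∷ ε ∷ [])
    rhs : a * ε * (b * ε) * (c * ε * (c * ε) + d * ε * (d * ε) + ε * ε)
            + (a * ε * (a * ε) + b * ε * (b * ε) + c * ε * (d * ε)) * (c * ε + d * ε) * ε
          ≡ ε * ε * ε * ε * (a * b * (c * c + d * d + 1) + (a * a + b * b + c * d) * (c + d))
    rhs = solve (a ∷ b ∷ c ∷ d ∷ ε ∷ [])

  Conditions : Pt → Set
  Conditions P = ∃ λ (a : ℕ) → ∃ λ (b : ℕ) → ∃ λ (c : ℕ) → ∃ λ (d : ℕ) →
    (val (Pt.a P) ≡ℕ a) × (val (Pt.b P) ≡ℕ b) × (val (Pt.c P) ≡ℕ c)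
    × (val (Pt.d P) ≡ℕ d) × (val (Pt.e P) ≡ℕ ε)
    × T P ≡ 0ℚ
    × IsNat (φ₁ P) × IsNat (φ₂ P) × IsNat (φ₃ P)
    × ε ∣ a × ε ∣ b × ε ∣ c × ε ∣ d × ε ∣ ε

  scaled-admissible⇒conditions : ∀ {P} → ScaledAdmissible P → Conditions P
  scaled-admissible⇒conditions
    (scaled-admissible {a} {b} {c} {d} A@(mkAdmissible k₁ k₂ k₃ φ₁≡k₁ φ₂≡k₂ φ₃≡k₃ T≡0 {{_}} {{_}} {{_}} {{_}}) refl) =
    a * ε , b * ε , c * ε , d * ε , refl , refl , refl , refl , refl ,
    Equivalence.from (T≡0⇔ S) (Equivalence.from (T-numerator⇔ {a} {b} {c} {d} {k₁} φ₁≡k₁) T≡0) ,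
    (k₁ , Equivalence.from (φ₁≡ℕ⇔ S k₁) φ₁≡k₁) ,
    (k₂ , Equivalence.from (φ₂≡ℕ⇔ S k₂) φ₂≡k₂) ,
    (k₃ , Equivalence.from (φ₃≡ℕ⇔ S k₃) φ₃≡k₃) ,
    divides a refl , divides b refl , divides c refl , divides d refl , ∣-refl
    where
    S : Scaled ε a b c d (scaledPt A)
    S = scaledPt-scaled A

  conditions⇒scaled-admissible : ∀ {P} → Conditions P → ScaledAdmissible P
  conditions⇒scaled-admissible {P}
    (_ , _ , _ , _ , a≡ , b≡ , c≡ , d≡ , e≡ , T≡0 , (k₁ , φ₁≡k₁) , (k₂ , φ₂≡k₂) , (k₃ , φ₃≡k₃) ,
     divides a refl , divides b refl , divides c refl , divides d refl , _) =
    scaled-admissible A (scaled⇒≡scaledPt S A)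
    where
    S : Scaled ε a b c d P
    S = scaled (val≡ a≡) (val≡ b≡) (val≡ c≡) (val≡ d≡) (val≡ e≡)
    instance
      a≢0 : NonZero a
      a≢0 = m*n≢0⇒m≢0 a {ε} {{≡ℕ⁺⇒≢0 (Scaled.a≡ S)}}
      b≢0 : NonZero b
      b≢0 = m*n≢0⇒m≢0 b {ε} {{≡ℕ⁺⇒≢0 (Scaled.b≡ S)}}
      c≢0 : NonZero c
      c≢0 = m*n≢0⇒m≢0 c {ε} {{≡ℕ⁺⇒≢0 (Scaled.c≡ S)}}
      d≢0 : NonZero d
      d≢0 = m*n≢0⇒m≢0 d {ε} {{≡ℕ⁺⇒≢0 (Scaled.d≡ S)}}
    φ₁≡k₁′ = Equivalence.to (φ₁≡ℕ⇔ S k₁) φ₁≡k₁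
    A : Admissible a b c d
    A = mkAdmissible k₁ k₂ k₃ φ₁≡k₁′ (Equivalence.to (φ₂≡ℕ⇔ S k₂) φ₂≡k₂) (Equivalence.to (φ₃≡ℕ⇔ S k₃) φ₃≡k₃)
          (Equivalence.to (T-numerator⇔ {a} {b} {c} {d} {k₁} φ₁≡k₁′) (Equivalence.to (T≡0⇔ S) T≡0))

theorem5p2 : (ε : ℕ) → .{{_ : NonZero ε}} → (P : Pt) →
    Orbit (diag ε) P ⇔
      (∃ λ (a : ℕ) → ∃ λ (b : ℕ) → ∃ λ (c : ℕ) → ∃ λ (d : ℕ) →
        (val (Pt.a P) ≡ℕ a) × (val (Pt.b P) ≡ℕ b) × (val (Pt.c P) ≡ℕ c)
        × (val (Pt.d P) ≡ℕ d) × (val (Pt.e P) ≡ℕ ε)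
        × T P ≡ 0ℚ
        × IsNat (φ₁ P) × IsNat (φ₂ P) × IsNat (φ₃ P)
        × ε ∣ a × ε ∣ b × ε ∣ c × ε ∣ d × ε ∣ ε)
theorem5p2 ε P = mk⇔
  (λ orbit → scaled-admissible⇒conditions ε (orbit⇒scaled-admissible ε orbit))
  (λ conditions → scaled-admissible⇒orbit ε (conditions⇒scaled-admissible ε conditions))
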